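{- Let $\mathcal{G}$ be a family of connected graphs of order $n\ge 2$ defined on a common vertex set. Then $\operatorname{Sd}_s(\mathcal{G})\le n-\operatorname{S\varpi}(\mathcal{G})$. Moreover, if every graph belonging to $\mathcal{G}$ has diameter two, then $\operatorname{Sd}_s(\mathcal{G})= n-\operatorname{S\varpi}(\mathcal{G})$.
   Context: All graphs are finite, simple and undirected. For a connected graph $G$, $d_G(x,y)$ denotes the length of a shortest $x$–$y$ path and $N_G[x]$ the closed neighbourhood of $x$. A vertex $w$ strongly resolves two vertices $u,v$ of $G$ if $d_G(u,w)=d_G(u,v)+d_G(v,w)$ or $d_G(v,w)=d_G(v,u)+d_G(u,w)$. A set $S\subseteq V(G)$ is a strong metric generator for $G$ if every two distinct vertices of $G$ are strongly resolved by some vertex of $S$. For a family $\mathcal G$ of connected graphs on a common vertex set $V$, $\operatorname{Sd}_s(\mathcal G)$ denotes the minimum cardinality of a set $S\subseteq V$ that is a strong metric generator for every graph in $\mathcal G$. Two vertices $x,y$ are true twins in $G$ if $N_G[x]=N_G[y]$. A twin-free clique of $G$ is a clique of $G$ containing no two distinct vertices that are true twins in $G$. A simultaneous twin-free clique of $\mathcal G$ is a set $W\subseteq V$ which is a twin-free clique in every $G\in\mathcal G$, and $\operatorname{S\varpi}(\mathcal G)$ is the maximum cardinality of a simultaneous twin-free clique of $\mathcal G$. -}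

module Defs where

open import Data.Nat using (ℕ; zero; suc; _+_; _≤_; _<_)
open import Data.Fin using (Fin)
open import Data.Fin.Subset using (Subset; _∈_; ∣_∣)
open import Data.Bool using (Bool; true; false)
open import Data.Product using (Σ; ∃; ∃-syntax; _×_; _,_)
open import Data.Sum using (_⊎_)
open import Relation.Nullary using (¬_)
open import Relation.Binary.PropositionalEquality using (_≡_; _≢_)
open import Function.Bundles using (_⇔_)

record Graph (n : ℕ) : Set where
  field
    adj    : Fin n → Fin n → Bool
    sym    : ∀ x y → adj x y ≡ adj y x
    irrefl : ∀ x → adj x x ≡ false
open Graph public

Adj : ∀ {n} → Graph n → Fin n → Fin n → Set
Adj G x y = adj G x y ≡ true

data Walk {n} (G : Graph n) : Fin n → Fin n → ℕ → Set where
  nil  : ∀ {x} → Walk G x x 0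
  cons : ∀ {x y z k} → Adj G x y → Walk G y z k → Walk G x z (suc k)

IsDist : ∀ {n} → Graph n → Fin n → Fin n → ℕ → Set
IsDist G x y k = Walk G x y k × (∀ m → m < k → ¬ Walk G x y m)

Connected : ∀ {n} → Graph n → Set
Connected G = ∀ x y → ∃[ k ] Walk G x y k

HasDiameterTwo : ∀ {n} → Graph n → Set
HasDiameterTwo G =
  (∀ x y → ∃[ k ] (IsDist G x y k × k ≤ 2)) × ∃[ x ] ∃[ y ] IsDist G x y 2

StronglyResolves : ∀ {n} → Graph n → Fin n → Fin n → Fin n → Set
StronglyResolves G w u v =
  (∃[ a ] ∃[ b ] ∃[ c ] (IsDist G u w a × IsDist G u v b × IsDist G v w c × a ≡ b + c))
  ⊎ (∃[ a ] ∃[ b ] ∃[ c ] (IsDist G v w a × IsDist G v u b × IsDist G u w c × a ≡ b + c))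

IsStrongMetricGenerator : ∀ {n} → Graph n → Subset n → Set
IsStrongMetricGenerator G S =
  ∀ u v → u ≢ v → ∃[ w ] (w ∈ S × StronglyResolves G w u v)

TrueTwins : ∀ {n} → Graph n → Fin n → Fin n → Set
TrueTwins G x y = ∀ z → ((z ≡ x ⊎ Adj G x z) ⇔ (z ≡ y ⊎ Adj G y z))

IsTwinFreeClique : ∀ {n} → Graph n → Subset n → Set
IsTwinFreeClique G W =
  (∀ x y → x ∈ W → y ∈ W → x ≢ y → Adj G x y)
  × (∀ x y → x ∈ W → y ∈ W → x ≢ y → ¬ TrueTwins G x y)

IsSimStrongMetricGenerator : ∀ {n} {I : Set} → (I → Graph n) → Subset n → Set
IsSimStrongMetricGenerator 𝒢 S = ∀ i → IsStrongMetricGenerator (𝒢 i) S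

IsSimTwinFreeClique : ∀ {n} {I : Set} → (I → Graph n) → Subset n → Set
IsSimTwinFreeClique 𝒢 W = ∀ i → IsTwinFreeClique (𝒢 i) W

IsSimStrongMetricDim : ∀ {n} {I : Set} → (I → Graph n) → ℕ → Set
IsSimStrongMetricDim 𝒢 s =
  (∃[ S ] (IsSimStrongMetricGenerator 𝒢 S × ∣ S ∣ ≡ s))
  × (∀ S → IsSimStrongMetricGenerator 𝒢 S → s ≤ ∣ S ∣)

IsSimTwinFreeCliqueNumber : ∀ {n} {I : Set} → (I → Graph n) → ℕ → Set
IsSimTwinFreeCliqueNumber 𝒢 w =
  (∃[ W ] (IsSimTwinFreeClique 𝒢 W × ∣ W ∣ ≡ w))
  × (∀ W → IsSimTwinFreeClique 𝒢 W → ∣ W ∣ ≤ w)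

-- If W is a twin-free clique, every pair u ≠ v is strongly resolved by a vertex
-- outside W: by u or v itself if one of them lies outside W, and otherwise by a
-- vertex z in the closed neighbourhood of exactly one of them, say of u, since
-- then d(v,z) = 2 = d(v,u) + d(u,z). Hence ∁ W is a strong metric generator.
-- Conversely, in a graph of diameter two a vertex w ∉ {u,v} can only strongly
-- resolve u and v as the middle of a geodesic u – v – w (or v – u – w) of length
-- two, which forces u and v to be adjacent and not true twins; hence the
-- complement of a strong metric generator is a twin-free clique. Both
-- complementations act on a common vertex set, so they apply to a whole family
-- at once.
module Submission where

open import Defs hiding (sym)
open import Level using (Level)
open import Data.Nat using (ℕ; zero; suc; _+_; _≤_; _<_; _∸_; z≤n; s≤s)
open import Data.Nat.Properties
  using (module ≤-Reasoning; m<1+n⇒m<n∨m≡n; m+n≤o⇒n≤o; ∸-monoʳ-≤; m∸[m∸n]≡n; <-cmp; ≤-antisym; n<1+n; +-identityʳ)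
open import Data.Fin using (Fin; _≟_)
open import Data.Fin.Properties using (any?)
open import Data.Fin.Subset using (_∈_; _∉_; ∣_∣; ∁)
open import Data.Fin.Subset.Properties using (_∈?_; ∣p∣≤n; ∣∁p∣≡n∸∣p∣; x∈∁p⇒x∉p; x∉p⇒x∈∁p)
open import Data.Bool using (true)
open import Data.Bool.Properties using () renaming (_≟_ to _≟ᵇ_)
open import Data.Product using (∃-syntax; _×_; _,_; proj₁; proj₂)
open import Data.Sum using (_⊎_; inj₁; inj₂; [_,_]′)
open import Relation.Nullary using (¬_; Dec; yes; no; contradiction)
open import Relation.Nullary.Decidable using (_×-dec_; _⊎-dec_; ¬?; decidable-stable)
open import Relation.Unary using (Pred; Decidable)
open import Relation.Binary using (tri<; tri≈; tri>)
open import Relation.Binary.PropositionalEquality using (_≡_; _≢_; ≢-sym; refl; sym; trans; subst)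
open import Function.Bundles using (mk⇔; Equivalence)
open import Function.Properties.Equivalence using () renaming (sym to ⇔-sym)

private
  variable
    ℓ : Level

Least : Pred ℕ ℓ → Pred ℕ ℓ
Least P m = P m × (∀ j → j < m → ¬ P j)

bounded-least-witness : {P : Pred ℕ ℓ} → Decidable P → ∀ k → (∀ j → j < k → ¬ P j) ⊎ ∃[ m ] Least P m
bounded-least-witness P? zero = inj₁ (λ _ ())
bounded-least-witness P? (suc k) with bounded-least-witness P? k
... | inj₂ found = inj₂ found
... | inj₁ none-below with P? k
...   | yes pk = inj₂ (k , pk , none-below)
...   | no ¬pk = inj₁ λ j j<1+k → [ none-below j , (λ { refl → ¬pk }) ]′ (m<1+n⇒m<n∨m≡n j<1+k)

least-witness : {P : Pred ℕ ℓ} → Decidable P → ∀ {k} → P k → ∃[ m ] Least P m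
least-witness P? {k} pk with bounded-least-witness P? (suc k)
... | inj₁ none-below = contradiction pk (none-below k (n<1+n k))
... | inj₂ found = found

positive-summands-of-two : ∀ {b c} → 1 ≤ b → 1 ≤ c → b + c ≤ 2 → b ≡ 1 × c ≡ 1
positive-summands-of-two {suc zero} {suc zero} _ _ _ = refl , refl
positive-summands-of-two {suc zero} {suc (suc _)} _ _ (s≤s (s≤s ()))
positive-summands-of-two {suc (suc b)} {suc c} _ _ (s≤s (s≤s b+c≤0)) with m+n≤o⇒n≤o b b+c≤0
... | ()

n∸m≤k⇒n∸k≤m : ∀ {m n k} → m ≤ n → n ∸ m ≤ k → n ∸ k ≤ m
n∸m≤k⇒n∸k≤m {m} {n} {k} m≤n n∸m≤k = begin
  n ∸ k        ≤⟨ ∸-monoʳ-≤ n n∸m≤k ⟩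
  n ∸ (n ∸ m)  ≡⟨ m∸[m∸n]≡n m≤n ⟩
  m            ∎
  where open ≤-Reasoning

module _ {n} (G : Graph n) where

  private
    variable
      u v w x y z : Fin n
      a b k : ℕ

  Adj? : ∀ x y → Dec (Adj G x y)
  Adj? x y = adj G x y ≟ᵇ true

  adj-sym : Adj G x y → Adj G y x
  adj-sym {x} {y} xy = trans (Graph.sym G y x) xy

  adj⇒≢ : Adj G x y → x ≢ y
  adj⇒≢ {x} xy refl = contradiction (trans (sym (irrefl G x)) xy) λ ()

  walk₀⇒≡ : Walk G x y 0 → x ≡ y
  walk₀⇒≡ nil = refl

  walk₁⇒adj : Walk G x y 1 → Adj G x y
  walk₁⇒adj (cons xy nil) = xy

  walk-length-pos : x ≢ y → Walk G x y k → 1 ≤ k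
  walk-length-pos {k = zero}  x≢y p = contradiction (walk₀⇒≡ p) x≢y
  walk-length-pos {k = suc k} x≢y p = s≤s z≤n

  walk? : ∀ k x y → Dec (Walk G x y k)
  walk? zero x y with x ≟ y
  ... | yes refl = yes nil
  ... | no x≢y = no λ p → x≢y (walk₀⇒≡ p)
  walk? (suc k) x y with any? (λ z → Adj? x z ×-dec walk? k z y)
  ... | yes (z , xz , p) = yes (cons xz p)
  ... | no ¬step = no λ { (cons {y = z} xz p) → ¬step (z , xz , p) }

  dist-exists : Connected G → ∀ x y → ∃[ k ] IsDist G x y k
  dist-exists connected x y = least-witness (λ k → walk? k x y) (proj₂ (connected x y))

  dist-unique : IsDist G x y a → IsDist G x y b → a ≡ b
  dist-unique {a = a} {b} (pa , minimal-a) (pb , minimal-b) with <-cmp a b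
  ... | tri< a<b _ _ = contradiction pa (minimal-b a a<b)
  ... | tri≈ _ a≡b _ = a≡b
  ... | tri> _ _ b<a = contradiction pb (minimal-a b b<a)

  dist-refl : IsDist G x x 0
  dist-refl = nil , λ _ ()

  dist-adj : Adj G x y → IsDist G x y 1
  dist-adj xy = cons xy nil , λ { zero _ p → adj⇒≢ xy (walk₀⇒≡ p) ; (suc _) (s≤s ()) }

  dist-two : x ≢ y → ¬ Adj G x y → Adj G x z → Adj G z y → IsDist G x y 2
  dist-two x≢y ¬xy xz zy = cons xz (cons zy nil) , λ
    { zero _ p → x≢y (walk₀⇒≡ p)
    ; (suc zero) _ p → ¬xy (walk₁⇒adj p)
    ; (suc (suc _)) (s≤s (s≤s ()))
    }

  -- v lies on a shortest u–w path;
  -- StronglyResolves G w u v unfolds to OnGeodesic u v w ⊎ OnGeodesic v u w.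
  OnGeodesic : Fin n → Fin n → Fin n → Set
  OnGeodesic u v w =
    ∃[ a ] ∃[ b ] ∃[ c ] (IsDist G u w a × IsDist G u v b × IsDist G v w c × a ≡ b + c)

  resolves-sym : StronglyResolves G w u v → StronglyResolves G w v u
  resolves-sym (inj₁ g) = inj₂ g
  resolves-sym (inj₂ g) = inj₁ g

  resolves-by-left : Connected G → ∀ u v → StronglyResolves G u u v
  resolves-by-left connected u v with dist-exists connected v u
  ... | k , dvu = inj₂ (k , k , 0 , dvu , dvu , dist-refl , sym (+-identityʳ k))

  resolves-by-right : Connected G → ∀ u v → StronglyResolves G v u v
  resolves-by-right connected u v = resolves-sym (resolves-by-left connected v u)

  ClosedNbhd : Fin n → Fin n → Set
  ClosedNbhd x z = z ≡ x ⊎ Adj G x z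

  closedNbhd? : ∀ x z → Dec (ClosedNbhd x z)
  closedNbhd? x z = (z ≟ x) ⊎-dec Adj? x z

  PrivateNeighbour : Fin n → Fin n → Fin n → Set
  PrivateNeighbour u v z = ClosedNbhd u z × ¬ ClosedNbhd v z

  privateNeighbour? : ∀ u v z → Dec (PrivateNeighbour u v z)
  privateNeighbour? u v z = closedNbhd? u z ×-dec ¬? (closedNbhd? v z)

  ¬twins⇒private-neighbour : ¬ TrueTwins G u v →
    ∃[ z ] (PrivateNeighbour u v z ⊎ PrivateNeighbour v u z)
  ¬twins⇒private-neighbour {u} {v} ¬twins
    with any? (λ z → privateNeighbour? u v z ⊎-dec privateNeighbour? v u z)
  ... | yes found = found
  ... | no none = contradiction twins ¬twins
    where
    twins : TrueTwins G u v
    twins z = mk⇔ (λ uz → decidable-stable (closedNbhd? v z) λ ¬vz → none (z , inj₁ (uz , ¬vz)))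
                  (λ vz → decidable-stable (closedNbhd? u z) λ ¬uz → none (z , inj₂ (vz , ¬uz)))

  private-neighbour-resolves : Adj G u v → PrivateNeighbour u v z → StronglyResolves G z u v
  private-neighbour-resolves {u} {v} {z} uv (uz , ¬vz) =
    inj₂ (2 , 1 , 1 , dist-two v≢z ¬v~z vu u~z , dist-adj vu , dist-adj u~z , refl)
    where
    vu : Adj G v u
    vu = adj-sym uv
    v≢z : v ≢ z
    v≢z v≡z = ¬vz (inj₁ (sym v≡z))
    ¬v~z : ¬ Adj G v z
    ¬v~z vz = ¬vz (inj₂ vz)
    u~z : Adj G u z
    u~z = [ (λ { refl → contradiction (inj₂ vu) ¬vz }) , (λ u~z → u~z) ]′ uz

  private-neighbour∉clique : ∀ {W} → IsTwinFreeClique G W → v ∈ W → PrivateNeighbour u v z → z ∉ W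
  private-neighbour∉clique (clique , _) v∈W (_ , ¬vz) z∈W =
    ¬vz (inj₂ (clique _ _ v∈W z∈W λ { refl → ¬vz (inj₁ refl) }))

  twinFreeClique⇒∁-strongMetricGenerator : Connected G →
    ∀ {W} → IsTwinFreeClique G W → IsStrongMetricGenerator G (∁ W)
  twinFreeClique⇒∁-strongMetricGenerator connected {W} W-clique@(adjacent , twin-free) u v u≢v
    with u ∈? W | v ∈? W
  ... | no u∉W | _      = u , x∉p⇒x∈∁p u∉W , resolves-by-left connected u v
  ... | yes _  | no v∉W = v , x∉p⇒x∈∁p v∉W , resolves-by-right connected u v
  ... | yes u∈W | yes v∈W with ¬twins⇒private-neighbour (twin-free u v u∈W v∈W u≢v)
  ...   | z , inj₁ private-to-u =
          z , x∉p⇒x∈∁p (private-neighbour∉clique W-clique v∈W private-to-u) ,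
          private-neighbour-resolves (adjacent u v u∈W v∈W u≢v) private-to-u
  ...   | z , inj₂ private-to-v =
          z , x∉p⇒x∈∁p (private-neighbour∉clique W-clique u∈W private-to-v) ,
          resolves-sym (private-neighbour-resolves (adjacent v u v∈W u∈W (≢-sym u≢v)) private-to-v)

  twin-adj : TrueTwins G u v → w ≢ u → Adj G v w → Adj G u w
  twin-adj twins w≢u vw =
    [ (λ w≡u → contradiction w≡u w≢u) , (λ uw → uw) ]′ (Equivalence.from (twins _) (inj₂ vw))

  module _ (dist≤2-exists : ∀ x y → ∃[ k ] (IsDist G x y k × k ≤ 2)) where

    dist≤2 : IsDist G x y a → a ≤ 2
    dist≤2 {x} {y} dxy with dist≤2-exists x y
    ... | k , dxy′ , k≤2 = subst (_≤ 2) (dist-unique dxy′ dxy) k≤2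

    geodesic-interior : u ≢ v → v ≢ w → OnGeodesic u v w → Adj G u v × Adj G v w × ¬ Adj G u w
    geodesic-interior u≢v v≢w (a , b , c , duw , duv , dvw , a≡b+c)
      with positive-summands-of-two (walk-length-pos u≢v (proj₁ duv)) (walk-length-pos v≢w (proj₁ dvw))
             (subst (_≤ 2) a≡b+c (dist≤2 duw))
    ... | refl , refl =
      walk₁⇒adj (proj₁ duv) , walk₁⇒adj (proj₁ dvw) ,
      λ uw → proj₂ duw 1 (subst (1 <_) (sym a≡b+c) (s≤s (s≤s z≤n))) (cons uw nil)

    outer-resolver-separates : w ≢ u → w ≢ v → u ≢ v →
      StronglyResolves G w u v → Adj G u v × ¬ TrueTwins G u v
    outer-resolver-separates w≢u w≢v u≢v (inj₁ geodesic)
      with geodesic-interior u≢v (≢-sym w≢v) geodesic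
    ... | uv , vw , ¬uw = uv , λ twins → ¬uw (twin-adj twins w≢u vw)
    outer-resolver-separates w≢u w≢v u≢v (inj₂ geodesic)
      with geodesic-interior (≢-sym u≢v) (≢-sym w≢u) geodesic
    ... | vu , uw , ¬vw = adj-sym vu , λ twins → ¬vw (twin-adj (λ z → ⇔-sym (twins z)) w≢v uw)

    strongMetricGenerator⇒∁-twinFreeClique : ∀ {S} → IsStrongMetricGenerator G S → IsTwinFreeClique G (∁ S)
    strongMetricGenerator⇒∁-twinFreeClique {S} generator =
      (λ u v u∉S v∉S u≢v → proj₁ (separated u v u∉S v∉S u≢v)) ,
      (λ u v u∉S v∉S u≢v → proj₂ (separated u v u∉S v∉S u≢v))
      where
      separated : ∀ u v → u ∈ ∁ S → v ∈ ∁ S → u ≢ v → Adj G u v × ¬ TrueTwins G u v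
      separated u v u∉S v∉S u≢v with generator u v u≢v
      ... | w , w∈S , resolves = outer-resolver-separates (∈∧∈∁⇒≢ w∈S u∉S) (∈∧∈∁⇒≢ w∈S v∉S) u≢v resolves
        where
        ∈∧∈∁⇒≢ : ∀ {x y} → x ∈ S → y ∈ ∁ S → x ≢ y
        ∈∧∈∁⇒≢ x∈S y∈∁S refl = x∈∁p⇒x∉p y∈∁S x∈S

mainTheorem3 : (n : ℕ) → 2 ≤ n → {I : Set} → (𝒢 : I → Graph n) →
    (∀ i → Connected (𝒢 i)) →
    (s w : ℕ) → IsSimStrongMetricDim 𝒢 s → IsSimTwinFreeCliqueNumber 𝒢 w →
    (s ≤ n ∸ w) × ((∀ i → HasDiameterTwo (𝒢 i)) → s ≡ n ∸ w)
mainTheorem3 n _ 𝒢 connected _ _ ((S , S-generator , refl) , minimal) ((W , W-clique , refl) , maximal) =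
  ∣S∣≤n∸∣W∣ , λ diameter-two → ≤-antisym ∣S∣≤n∸∣W∣ (n∸m≤k⇒n∸k≤m (∣p∣≤n S) (n∸∣S∣≤∣W∣ diameter-two))
  where
  ∣S∣≤n∸∣W∣ : ∣ S ∣ ≤ n ∸ ∣ W ∣
  ∣S∣≤n∸∣W∣ = subst (∣ S ∣ ≤_) (∣∁p∣≡n∸∣p∣ W) (minimal (∁ W) λ i →
    twinFreeClique⇒∁-strongMetricGenerator (𝒢 i) (connected i) (W-clique i))

  n∸∣S∣≤∣W∣ : (∀ i → HasDiameterTwo (𝒢 i)) → n ∸ ∣ S ∣ ≤ ∣ W ∣
  n∸∣S∣≤∣W∣ diameter-two = subst (_≤ ∣ W ∣) (∣∁p∣≡n∸∣p∣ S) (maximal (∁ S) λ i →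
    strongMetricGenerator⇒∁-twinFreeClique (𝒢 i) (proj₁ (diameter-two i)) (S-generator i))
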